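{- For all integers $n,r,s\ge 1$, $\chi_{la}\big((2r+1)[(2s+1)P_2\vee O_{2n+1}]\big)=3$.
   Context: For a graph $G$ with $q$ edges, a bijection $f:E(G)\to\{1,\dots,q\}$ is a local antimagic labeling if $f^+(u)\neq f^+(v)$ for every edge $uv$, where $f^+(u)$ is the sum of the labels of edges incident to $u$; $\chi_{la}(G)$ is the minimum number of distinct values of $f^+$ over all local antimagic labelings of $G$. $O_m$ is the null graph on $m$ vertices, $aP_2$ is the disjoint union of $a$ copies of $P_2$ (a single edge), $G\vee H$ is the join of $G$ and $H$, and $(2r+1)[G]$ denotes the disjoint union of $2r+1$ copies of $G$. -}

module Defs where

open import Data.Nat using (ℕ; _+_; _*_; _≤_)
import Data.Nat as ℕ
open import Data.Nat.ListAction using (sum)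
open import Data.Nat.Properties using (_≟_)
open import Data.Fin using (Fin; zero; suc; toℕ; combine; _↑ˡ_; _↑ʳ_)
import Data.Fin.Properties as FinP
open import Data.List using (List; []; _∷_; length; map; concatMap; lookup; deduplicate; _++_; allFin)
open import Data.Product using (_×_; _,_; proj₁; proj₂; Σ; Σ-syntax)
open import Data.Bool using (Bool; if_then_else_; _∨_)
open import Relation.Nullary using (¬_)
open import Relation.Nullary.Decidable using (⌊_⌋)
open import Relation.Binary.PropositionalEquality using (_≡_)
open import Function.Definitions using (Bijective)

-- A finite graph: vertex set Fin V, edges given as a list of (unordered) pairs of endpoints.
record Graph : Set where
  field
    V : ℕ
    E : List (Fin V × Fin V)
open Graph public

size : Graph → ℕ
size G = length (E G)

-- An edge labeling: f : Fin q → Fin q; edge i receives the label toℕ (f i) + 1 ∈ {1..q}.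
Labeling : Graph → Set
Labeling G = Fin (size G) → Fin (size G)

IsBijectiveLabeling : (G : Graph) → Labeling G → Set
IsBijectiveLabeling G f = Bijective _≡_ _≡_ f

incident : {V : ℕ} → Fin V → Fin V × Fin V → Bool
incident u (a , b) = ⌊ u FinP.≟ a ⌋ ∨ ⌊ u FinP.≟ b ⌋

fplus : (G : Graph) → Labeling G → Fin (V G) → ℕ
fplus G f u =
  sum (map (λ i → if incident u (lookup (E G) i) then ℕ.suc (toℕ (f i)) else 0)
           (allFin (size G)))

IsLocalAntimagic : (G : Graph) → Labeling G → Set
IsLocalAntimagic G f =
  IsBijectiveLabeling G f ×
  ((i : Fin (size G)) →
     ¬ (fplus G f (proj₁ (lookup (E G) i)) ≡ fplus G f (proj₂ (lookup (E G) i))))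

numColours : (G : Graph) → Labeling G → ℕ
numColours G f = length (deduplicate _≟_ (map (fplus G f) (allFin (V G))))

ChiLaEq : Graph → ℕ → Set
ChiLaEq G k =
  (Σ[ f ∈ Labeling G ] (IsLocalAntimagic G f × numColours G f ≡ k)) ×
  ((f : Labeling G) → IsLocalAntimagic G f → k ≤ numColours G f)

-- The graph (2s+1)P₂ ∨ O_{2n+1}, for parameters a = 2s+1, m = 2n+1.
-- Vertices: matching vertices (i , b), i < a, b < 2, encoded as combine i b ↑ˡ m;
-- independent vertices j < m, encoded as (a * 2) ↑ʳ j.
joinV : ℕ → ℕ → ℕ
joinV a m = a * 2 + m

mv : {a : ℕ} (m : ℕ) → Fin a → Fin 2 → Fin (joinV a m)
mv m i b = combine i b ↑ˡ m

iv : (a : ℕ) {m : ℕ} → Fin m → Fin (joinV a m)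
iv a j = (a * 2) ↑ʳ j

joinEdges : (a m : ℕ) → List (Fin (joinV a m) × Fin (joinV a m))
joinEdges a m =
  map (λ i → (mv m i zero , mv m i (suc zero))) (allFin a)
  ++ concatMap (λ i → concatMap (λ b → map (λ j → (mv m i b , iv a j)) (allFin m))
                                (allFin 2))
               (allFin a)

copies : ℕ → Graph → Graph
copies c G = record
  { V = c * V G
  ; E = concatMap (λ k → map (λ e → (combine k (proj₁ e) , combine k (proj₂ e))) (E G))
                  (allFin c)
  }

theGraph : (n r s : ℕ) → Graph
theGraph n r s =
  copies (2 * r + 1)
    (record { V = joinV (2 * s + 1) (2 * n + 1) ; E = joinEdges (2 * s + 1) (2 * n + 1) })

-- Write a = 2s+1, c = 2r+1, m = 2n+1 and P = ac. The matching edge i of copy k gets a number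
-- h = cell k i: a bijection onto Fin P whose sum over the a matching edges of a copy is the same
-- for every copy (cell k i = c·i + column i k, where columns 0, 1, 2 are the rows of a 3 × c array
-- with all column sums 3r and the remaining ones alternate between k and 2r − k).
-- The spoke from matching vertex (k, i, b) to independent vertex j gets label 1 + 2P·d + P·b + flip d h,
-- where d = j for b = 0 and d = 2n − j for b = 1, and flip d h is P − 1 − h if d < n and h otherwise;
-- the matching edge gets 1 + 2Pm + (P − 1 − h).
-- At a matching vertex the spokes run through every digit d once, so h occurs n + 1 times and,
-- counting the matching edge, so does P − 1 − h: the sum does not depend on h. At an independent
-- vertex j ≠ n the two spokes from the ends of one matching edge have digits j and 2n − j, exactly
-- one of which is below n, and their labels add up to 2Pm + 1; for j = n neither is flipped and the
-- constant sum of h over a copy gives the same total. So f⁺ takes the three values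
-- (n + 1)(2Pm + 1 + P), that plus mP, and a(2Pm + 1), which differ since only the last is a multiple
-- of 2Pm + 1. Three colours are necessary because every copy contains triangles.

module Submission where

open import Defs
open import Data.Nat using (ℕ; _≤_)
open import Data.Nat as ℕ using (zero; suc; _+_; _*_; _∸_; _<_; z≤n; s≤s; _≤?_; _<?_)
import Data.Nat.Properties as ℕP
open import Data.Nat.DivMod using (_%_; m<n⇒m%n≡m; [m+kn]%n≡m%n; m*n%n≡0)
open import Data.Nat.ListAction using (sum)
import Data.Nat.ListAction.Properties as SumP
open import Data.Nat.Tactic.RingSolver using (solve-∀)
open import Data.Bool using (true; false; if_then_else_; _∨_; _∧_)
import Data.Bool.Properties as BoolP
open import Data.Empty using (⊥-elim)
open import Data.Product using (_×_; _,_; proj₁; proj₂; ∃)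
open import Data.Sum using (_⊎_; inj₁; inj₂)
open import Data.Fin as Fin using (Fin; zero; suc; toℕ; fromℕ<; combine; remQuot; opposite; _↑ˡ_; _↑ʳ_; splitAt)
open import Data.Fin.Properties as FinP using (_≟_; any?)
import Data.Fin.Permutation as Perm
open import Data.List using (List; []; _∷_; length; map; concatMap; lookup; deduplicate; _++_; allFin; tabulate)
import Data.List.Properties as ListP
open import Data.List.Membership.Propositional using (_∈_)
import Data.List.Membership.Propositional.Properties as ∈P
open import Data.List.Relation.Unary.Any as Any using (here; there; index; _─_)
import Data.List.Relation.Unary.Any.Properties as AnyP
open import Data.List.Relation.Unary.All as All using ([]; _∷_)
open import Data.List.Relation.Unary.AllPairs using ([]; _∷_)
open import Data.List.Relation.Unary.Unique.Propositional using (Unique)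
import Data.List.Relation.Unary.Unique.DecPropositional.Properties as UniqueP
open import Function using (_∘_; id; mk⇔)
open import Function.Definitions using (Injective; StrictlySurjective; Bijective)
open import Function.Consequences.Propositional using (strictlySurjective⇒surjective)
open import Relation.Nullary using (¬_; yes; no; contradiction)
open import Relation.Nullary.Decidable using (does; dec-true; dec-false; does-⇔; _×-dec_; isYes≗does)
open import Relation.Binary.Definitions using (tri<; tri≈; tri>)
open import Relation.Binary.PropositionalEquality
open import Algebra.Properties.CommutativeMonoid.Sum ℕP.+-0-commutativeMonoid
  using (sum-syntax; ∑-distrib-+; ∑-permute; sum-cong-≗)

open ≡-Reasoning

∑-const : ∀ n x → ∑[ i < n ] x ≡ n * x
∑-const zero x = refl
∑-const (suc n) x = cong (x +_) (∑-const n x)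

∑-*ˡ : ∀ {n} x (f : Fin n → ℕ) → ∑[ i < n ] (x * f i) ≡ x * ∑[ i < n ] f i
∑-*ˡ {zero} x f = sym (ℕP.*-zeroʳ x)
∑-*ˡ {suc n} x f = trans (cong (x * f zero +_) (∑-*ˡ x (f ∘ suc))) (sym (ℕP.*-distribˡ-+ x _ _))

∑-if : ∀ {n} b (f : Fin n → ℕ) → ∑[ i < n ] (if b then f i else 0) ≡ (if b then ∑[ i < n ] f i else 0)
∑-if true f = refl
∑-if {n} false f = trans (∑-const n 0) (ℕP.*-zeroʳ n)

-- `does` rather than ⌊_⌋ throughout: does (suc x ≟ suc y) reduces to does (x ≟ y), ⌊_⌋ does not.
∑-delta : ∀ {n} (x : Fin n) (f : Fin n → ℕ) → ∑[ i < n ] (if does (x ≟ i) then f i else 0) ≡ f x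
∑-delta {suc n} zero f = trans (cong (f zero +_) (∑-if false (f ∘ suc))) (ℕP.+-identityʳ (f zero))
∑-delta {suc n} (suc x) f = ∑-delta x (f ∘ suc)

∑-opposite : ∀ {n} (f : Fin n → ℕ) → ∑[ i < n ] f (opposite i) ≡ ∑[ i < n ] f i
∑-opposite f = sym (∑-permute f Perm.reverse)

∑-if-toℕ< : ∀ x y (A B : ℕ) → ∑[ i < x + y ] (if does (toℕ i <? x) then A else B) ≡ x * A + y * B
∑-if-toℕ< zero y A B = ∑-const y B
∑-if-toℕ< (suc x) y A B = trans (cong (A +_) (∑-if-toℕ< x y A B)) (sym (ℕP.+-assoc A _ _))

∑-toℕ : ∀ n → 2 * ∑[ i < n ] toℕ i + n ≡ n * n
∑-toℕ zero = refl
∑-toℕ (suc n) = begin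
  2 * ∑[ i < n ] (1 + toℕ i) + suc n
    ≡⟨ cong (λ t → 2 * t + suc n) (trans (∑-distrib-+ {n} (λ _ → 1) toℕ) (cong (_+ S) (∑-const n 1))) ⟩
  2 * (n * 1 + S) + suc n      ≡⟨ regroup n S ⟩
  (2 * S + n) + (2 * n + 1)    ≡⟨ cong (_+ (2 * n + 1)) (∑-toℕ n) ⟩
  n * n + (2 * n + 1)          ≡⟨ square n ⟩
  suc n * suc n                ∎
  where
  S = ∑[ i < n ] toℕ i
  regroup : ∀ n S → 2 * (n * 1 + S) + suc n ≡ (2 * S + n) + (2 * n + 1)
  regroup = solve-∀
  square : ∀ n → n * n + (2 * n + 1) ≡ suc n * suc n
  square = solve-∀

∑-toℕ-odd : ∀ n → ∑[ i < 2 * n + 1 ] toℕ i ≡ n * (2 * n + 1)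
∑-toℕ-odd n = ℕP.*-cancelˡ-≡ (∑[ i < 2 * n + 1 ] toℕ i) (n * (2 * n + 1)) 2
  (ℕP.+-cancelʳ-≡ (2 * n + 1) _ _ (trans (∑-toℕ (2 * n + 1)) (square n)))
  where
  square : ∀ n → (2 * n + 1) * (2 * n + 1) ≡ 2 * (n * (2 * n + 1)) + (2 * n + 1)
  square = solve-∀

∑-affine : ∀ {N} α β (f : Fin N → ℕ) →
  ∑[ d < N ] suc (α * toℕ d + (β + f d)) ≡ N + (α * ∑[ d < N ] toℕ d + (N * β + ∑[ d < N ] f d))
∑-affine {N} α β f = begin
  ∑[ d < N ] (1 + (α * toℕ d + (β + f d)))
    ≡⟨ ∑-distrib-+ {N} (λ _ → 1) (λ d → α * toℕ d + (β + f d)) ⟩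
  ∑[ d < N ] 1 + ∑[ d < N ] (α * toℕ d + (β + f d))
    ≡⟨ cong₂ _+_ (trans (∑-const N 1) (ℕP.*-identityʳ N))
                 (∑-distrib-+ {N} (λ d → α * toℕ d) (λ d → β + f d)) ⟩
  N + (∑[ d < N ] (α * toℕ d) + ∑[ d < N ] (β + f d))
    ≡⟨ cong (N +_) (cong₂ _+_ (∑-*ˡ {N} α toℕ)
                              (trans (∑-distrib-+ {N} (λ _ → β) f) (cong (_+ _) (∑-const N β)))) ⟩
  N + (α * ∑[ d < N ] toℕ d + (N * β + ∑[ d < N ] f d)) ∎

sum-tabulate : ∀ {n} (f : Fin n → ℕ) → sum (tabulate f) ≡ ∑[ i < n ] f i
sum-tabulate {zero} f = refl
sum-tabulate {suc n} f = cong (f zero +_) (sum-tabulate (f ∘ suc))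

sum-map-allFin : ∀ {n} (f : Fin n → ℕ) → sum (map f (allFin n)) ≡ ∑[ i < n ] f i
sum-map-allFin f = trans (cong sum (ListP.map-tabulate id f)) (sum-tabulate f)

sum-map-map-allFin : ∀ {A : Set} {n} (w : A → ℕ) (g : Fin n → A) →
  sum (map w (map g (allFin n))) ≡ ∑[ i < n ] w (g i)
sum-map-map-allFin {n = n} w g = trans (cong sum (sym (ListP.map-∘ {g = w} {f = g} (allFin n)))) (sum-map-allFin (w ∘ g))

sum-map-concatMap : ∀ {A B : Set} (w : B → ℕ) (F : A → List B) xs →
  sum (map w (concatMap F xs)) ≡ sum (map (λ x → sum (map w (F x))) xs)
sum-map-concatMap w F [] = refl
sum-map-concatMap w F (x ∷ xs) = begin
  sum (map w (F x ++ concatMap F xs))               ≡⟨ cong sum (ListP.map-++ w (F x) _) ⟩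
  sum (map w (F x) ++ map w (concatMap F xs))       ≡⟨ SumP.sum-++ (map w (F x)) _ ⟩
  sum (map w (F x)) + sum (map w (concatMap F xs))  ≡⟨ cong (_ +_) (sum-map-concatMap w F xs) ⟩
  sum (map w (F x)) + sum (map (λ x → sum (map w (F x))) xs) ∎

sum-map-if : ∀ {A : Set} b (g : A → ℕ) xs →
  sum (map (λ x → if b then g x else 0) xs) ≡ (if b then sum (map g xs) else 0)
sum-map-if true g xs = refl
sum-map-if false g [] = refl
sum-map-if false g (x ∷ xs) = sum-map-if false g xs

length-allFin : ∀ n → length (allFin n) ≡ n
length-allFin n = ListP.length-tabulate id

length-concatMap : ∀ {A B : Set} (F : A → List B) xs → length (concatMap F xs) ≡ sum (map (length ∘ F) xs)
length-concatMap F [] = refl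
length-concatMap F (x ∷ xs) = trans (ListP.length-++ (F x)) (cong (length (F x) +_) (length-concatMap F xs))

map-lookup-allFin : ∀ {A : Set} (xs : List A) → map (lookup xs) (allFin (length xs)) ≡ xs
map-lookup-allFin xs = trans (ListP.map-tabulate id (lookup xs)) (ListP.tabulate-lookup xs)

toℕ-opposite : ∀ {n} (i : Fin n) → suc (toℕ i + toℕ (opposite i)) ≡ n
toℕ-opposite i = trans (cong (λ x → suc (toℕ i + x)) (FinP.opposite-prop i)) (ℕP.m+[n∸m]≡n (FinP.toℕ<n i))

toℕ+toℕ-opposite : ∀ {n} (i : Fin (2 * n + 1)) → toℕ i + toℕ (opposite i) ≡ n + n
toℕ+toℕ-opposite {n} i = ℕP.suc-injective (trans (toℕ-opposite i) (odd n))
  where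
  odd : ∀ n → 2 * n + 1 ≡ suc (n + n)
  odd = solve-∀

greatest : ∀ x → Fin (x + 1)
greatest x = fromℕ< (ℕP.m<m+n x ℕ.z<s)

does-injective : ∀ {m n} {f : Fin m → Fin n} → Injective _≡_ _≡_ f →
  ∀ x y → does (f x ≟ f y) ≡ does (x ≟ y)
does-injective {f = f} f-inj x y = does-⇔ (mk⇔ f-inj (cong f)) (f x ≟ f y) (x ≟ y)

does-combine : ∀ {m n} (i k : Fin m) (j l : Fin n) →
  does (combine i j ≟ combine k l) ≡ does (i ≟ k) ∧ does (j ≟ l)
does-combine i k j l =
  does-⇔ (mk⇔ (FinP.combine-injective i j k l) λ { (refl , refl) → refl })
    (combine i j ≟ combine k l) ((i ≟ k) ×-dec (j ≟ l))

↑ˡ≢↑ʳ : ∀ {m} n (x : Fin n) (y : Fin m) → x ↑ˡ m ≢ n ↑ʳ y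
↑ˡ≢↑ʳ {m} n x y eq with () ← trans (sym (FinP.splitAt-↑ˡ n x m))
                               (trans (cong (splitAt n) eq) (FinP.splitAt-↑ʳ n m y))

injective⇒strictlySurjective : ∀ {n} {f : Fin n → Fin n} → Injective _≡_ _≡_ f → StrictlySurjective _≡_ f
injective⇒strictlySurjective {suc n} {f} f-inj y with any? (λ x → f x ≟ y)
... | yes hit = hit
... | no miss = contradiction (FinP.injective⇒≤ punchOut-inj) ℕP.1+n≰n
  where
  avoids : ∀ x → y ≢ f x
  avoids x eq = miss (x , sym eq)
  punchOut-inj : Injective _≡_ _≡_ (λ x → Fin.punchOut (avoids x))
  punchOut-inj eq = f-inj (FinP.punchOut-injective (avoids _) (avoids _) eq)

strictlySurjective⇒bijective : ∀ {n} {f : Fin n → Fin n} → StrictlySurjective _≡_ f → Bijective _≡_ _≡_ f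
strictlySurjective⇒bijective {f = f} f-surj = f-inj , strictlySurjective⇒surjective f-surj
  where
  section : ∀ y → f (proj₁ (f-surj y)) ≡ y
  section y = proj₂ (f-surj y)
  section-inj : Injective _≡_ _≡_ (proj₁ ∘ f-surj)
  section-inj {y₁} {y₂} eq = trans (sym (section y₁)) (trans (cong f eq) (section y₂))
  f-inj : Injective _≡_ _≡_ f
  f-inj {x₁} {x₂} eq with injective⇒strictlySurjective section-inj x₁
                         | injective⇒strictlySurjective section-inj x₂
  ... | y₁ , refl | y₂ , refl = cong (proj₁ ∘ f-surj) (trans (sym (section y₁)) (trans eq (section y₂)))

∈-─ : ∀ {A : Set} {x y : A} {ys} (x∈ys : x ∈ ys) → y ∈ ys → x ≢ y → y ∈ (ys ─ x∈ys)
∈-─ (here refl) (here refl) x≢y = ⊥-elim (x≢y refl)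
∈-─ (here _) (there y∈ys) _ = y∈ys
∈-─ (there _) (here refl) _ = here refl
∈-─ (there x∈ys) (there y∈ys) x≢y = there (∈-─ x∈ys y∈ys x≢y)

unique⊆⇒length≤ : ∀ {A : Set} {xs ys : List A} → Unique xs → (∀ {x} → x ∈ xs → x ∈ ys) →
  length xs ≤ length ys
unique⊆⇒length≤ [] _ = z≤n
unique⊆⇒length≤ {xs = x ∷ xs} {ys} (x∉xs ∷ xs!) xs⊆ys =
  ℕP.≤-trans (s≤s (unique⊆⇒length≤ xs! λ y∈xs →
                    ∈-─ x∈ys (xs⊆ys (there y∈xs)) (All.lookup x∉xs y∈xs)))
             (ℕP.≤-reflexive (sym (ListP.length-removeAt′ ys (index x∈ys))))
  where
  x∈ys = xs⊆ys (here refl)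

-- Vertex sums and colours

weightAt : ∀ {V} → (Fin V × Fin V → ℕ) → Fin V → Fin V × Fin V → ℕ
weightAt ω u e = if incident u e then ω e else 0

weightAt-incident : ∀ {V} (ω : Fin V × Fin V → ℕ) u e {b} → incident u e ≡ b →
  weightAt ω u e ≡ (if b then ω e else 0)
weightAt-incident ω u e = cong (λ t → if t then ω e else 0)

incidentSum : ∀ {V} → (Fin V × Fin V → ℕ) → Fin V → List (Fin V × Fin V) → ℕ
incidentSum ω u es = sum (map (weightAt ω u) es)

incident-does : ∀ {V} (u : Fin V) e → incident u e ≡ does (u ≟ proj₁ e) ∨ does (u ≟ proj₂ e)
incident-does u (x , y) = cong₂ _∨_ (isYes≗does (u ≟ x)) (isYes≗does (u ≟ y))

if-∧ : ∀ x y (A : ℕ) → (if x ∧ y then A else 0) ≡ (if x then (if y then A else 0) else 0)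
if-∧ true y A = refl
if-∧ false y A = refl

fplus≡incidentSum : (G : Graph) (f : Labeling G) (ℓ : Fin (V G) × Fin (V G) → ℕ) →
  (∀ i → toℕ (f i) ≡ ℓ (lookup (E G) i)) → ∀ u → fplus G f u ≡ incidentSum (suc ∘ ℓ) u (E G)
fplus≡incidentSum G f ℓ f≗ℓ u = begin
  sum (map (λ i → if incident u (lookup (E G) i) then suc (toℕ (f i)) else 0) (allFin (size G)))
    ≡⟨ cong sum (ListP.map-cong (λ i → cong (λ t → if incident u (lookup (E G) i) then suc t else 0) (f≗ℓ i))
                                 (allFin (size G))) ⟩
  sum (map (W ∘ lookup (E G)) (allFin (size G)))       ≡⟨ cong sum (ListP.map-∘ (allFin (size G))) ⟩
  sum (map W (map (lookup (E G)) (allFin (size G))))   ≡⟨ cong (sum ∘ map W) (map-lookup-allFin (E G)) ⟩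
  sum (map W (E G))                                    ∎
  where
  W = weightAt (suc ∘ ℓ) u

liftEdge : ∀ {c V} → Fin c → Fin V × Fin V → Fin (c * V) × Fin (c * V)
liftEdge k e = (combine k (proj₁ e) , combine k (proj₂ e))

incident-liftEdge : ∀ {c V} (k k′ : Fin c) (w : Fin V) e →
  incident (combine k w) (liftEdge k′ e) ≡ does (k ≟ k′) ∧ incident w e
incident-liftEdge k k′ w (x , y) = begin
  incident (combine k w) (combine k′ x , combine k′ y)
    ≡⟨ incident-does (combine k w) _ ⟩
  does (combine k w ≟ combine k′ x) ∨ does (combine k w ≟ combine k′ y)
    ≡⟨ cong₂ _∨_ (does-combine k k′ w x) (does-combine k k′ w y) ⟩
  (does (k ≟ k′) ∧ does (w ≟ x)) ∨ (does (k ≟ k′) ∧ does (w ≟ y))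
    ≡⟨ BoolP.∧-distribˡ-∨ (does (k ≟ k′)) _ _ ⟨
  does (k ≟ k′) ∧ (does (w ≟ x) ∨ does (w ≟ y))
    ≡⟨ cong (does (k ≟ k′) ∧_) (incident-does w (x , y)) ⟨
  does (k ≟ k′) ∧ incident w (x , y) ∎

incidentSum-copies : ∀ c (H : Graph) ω (k : Fin c) (w : Fin (V H)) →
  incidentSum ω (combine k w) (E (copies c H)) ≡ incidentSum (ω ∘ liftEdge k) w (E H)
incidentSum-copies c H ω k w = begin
  incidentSum ω (combine k w) (E (copies c H))
    ≡⟨ sum-map-concatMap W (λ k′ → map (liftEdge k′) (E H)) (allFin c) ⟩
  sum (map (λ k′ → sum (map W (map (liftEdge k′) (E H)))) (allFin c))
    ≡⟨ sum-map-allFin {c} _ ⟩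
  ∑[ k′ < c ] sum (map W (map (liftEdge k′) (E H)))
    ≡⟨ sum-cong-≗ copy ⟩
  ∑[ k′ < c ] (if does (k ≟ k′) then incidentSum (ω ∘ liftEdge k′) w (E H) else 0)
    ≡⟨ ∑-delta k (λ k′ → incidentSum (ω ∘ liftEdge k′) w (E H)) ⟩
  incidentSum (ω ∘ liftEdge k) w (E H) ∎
  where
  W = weightAt ω (combine k w)
  copy : ∀ k′ → sum (map W (map (liftEdge k′) (E H)))
              ≡ (if does (k ≟ k′) then incidentSum (ω ∘ liftEdge k′) w (E H) else 0)
  copy k′ = begin
    sum (map W (map (liftEdge k′) (E H)))   ≡⟨ cong sum (ListP.map-∘ (E H)) ⟨
    sum (map (W ∘ liftEdge k′) (E H))
      ≡⟨ cong sum (ListP.map-cong (λ e → trans (weightAt-incident ω (combine k w) (liftEdge k′ e)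
                                                                   (incident-liftEdge k k′ w e))
                                              (if-∧ (does (k ≟ k′)) (incident w e) _)) (E H)) ⟩
    sum (map (λ e → if does (k ≟ k′) then (if incident w e then ω (liftEdge k′ e) else 0) else 0) (E H))
      ≡⟨ sum-map-if (does (k ≟ k′)) _ (E H) ⟩
    (if does (k ≟ k′) then incidentSum (ω ∘ liftEdge k′) w (E H) else 0) ∎

∈-copies⁺ : ∀ {c} (H : Graph) (k : Fin c) {e} → e ∈ E H → liftEdge k e ∈ E (copies c H)
∈-copies⁺ H k e∈ = ∈P.∈-concatMap⁺ (λ k → map (liftEdge k) (E H))
  (Any.map (λ { refl → ∈P.∈-map⁺ (liftEdge k) e∈ }) (∈P.∈-allFin k))

∈-copies⁻ : ∀ {c} (H : Graph) {e} → e ∈ E (copies c H) →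
  ∃ λ k → ∃ λ e′ → e′ ∈ E H × e ≡ liftEdge k e′
∈-copies⁻ {c} H e∈
  with k , e∈k ← Any.satisfied (∈P.∈-concatMap⁻ (λ k → map (liftEdge k) (E H)) {xs = allFin c} e∈)
  with e′ , e′∈ , refl ← ∈P.∈-map⁻ (liftEdge k) e∈k = k , e′ , e′∈ , refl

size-copies : ∀ c (H : Graph) → size (copies c H) ≡ c * size H
size-copies c H = begin
  length (concatMap (λ k → map (liftEdge k) (E H)) (allFin c))
    ≡⟨ length-concatMap (λ k → map (liftEdge k) (E H)) (allFin c) ⟩
  sum (map (λ k → length (map (liftEdge k) (E H))) (allFin c))
    ≡⟨ sum-map-allFin {c} (λ k → length (map (liftEdge k) (E H))) ⟩
  ∑[ k < c ] length (map (liftEdge k) (E H))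
    ≡⟨ sum-cong-≗ {c} (λ k → ListP.length-map (liftEdge k) (E H)) ⟩
  ∑[ k < c ] size H
    ≡⟨ ∑-const c (size H) ⟩
  c * size H ∎

module _ (G : Graph) (f : Labeling G) where

  private
    colourList : List ℕ
    colourList = deduplicate ℕP._≟_ (map (fplus G f) (allFin (V G)))

    ∈-colourList : ∀ u → fplus G f u ∈ colourList
    ∈-colourList u = ∈P.∈-deduplicate⁺ ℕP._≟_ (∈P.∈-map⁺ (fplus G f) (∈P.∈-allFin u))

  ≤-numColours : ∀ {xs} → Unique xs → (∀ {x} → x ∈ xs → ∃ λ u → fplus G f u ≡ x) →
    length xs ≤ numColours G f
  ≤-numColours xs! attained = unique⊆⇒length≤ xs! λ x∈xs →
    subst (_∈ colourList) (proj₂ (attained x∈xs)) (∈-colourList (proj₁ (attained x∈xs)))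

  numColours-≡ : ∀ {xs} → Unique xs → (∀ u → fplus G f u ∈ xs) →
    (∀ {x} → x ∈ xs → ∃ λ u → fplus G f u ≡ x) → numColours G f ≡ length xs
  numColours-≡ xs! ⊆xs attained = ℕP.≤-antisym
    (unique⊆⇒length≤ (UniqueP.deduplicate-! ℕP._≟_ _) λ c∈ →
       colour∈xs (∈P.∈-map⁻ (fplus G f) (∈P.∈-deduplicate⁻ ℕP._≟_ _ c∈)))
    (≤-numColours xs! attained)
    where
    colour∈xs : ∀ {c} → ∃ (λ u → u ∈ allFin (V G) × c ≡ fplus G f u) → c ∈ _
    colour∈xs (u , _ , refl) = ⊆xs u

  localAntimagic⇒≢ : IsLocalAntimagic G f → ∀ {x y} → (x , y) ∈ E G → fplus G f x ≢ fplus G f y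
  localAntimagic⇒≢ (_ , proper) xy∈ =
    subst (λ e → fplus G f (proj₁ e) ≢ fplus G f (proj₂ e)) (sym (AnyP.lookup-index xy∈)) (proper (index xy∈))

  triangle⇒3≤numColours : IsLocalAntimagic G f →
    ∀ {x y z} → (x , y) ∈ E G → (x , z) ∈ E G → (y , z) ∈ E G → 3 ≤ numColours G f
  triangle⇒3≤numColours lam {x} {y} {z} xy xz yz = ≤-numColours distinct attained
    where
    distinct : Unique (fplus G f x ∷ fplus G f y ∷ fplus G f z ∷ [])
    distinct = (localAntimagic⇒≢ lam xy ∷ localAntimagic⇒≢ lam xz ∷ [])
             ∷ (localAntimagic⇒≢ lam yz ∷ []) ∷ [] ∷ []
    attained : ∀ {c} → c ∈ fplus G f x ∷ fplus G f y ∷ fplus G f z ∷ [] → ∃ λ u → fplus G f u ≡ c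
    attained (here refl) = x , refl
    attained (there (here refl)) = y , refl
    attained (there (there (here refl))) = z , refl

-- The join of a copies of P₂ with m independent vertices

module JoinGraph (a m : ℕ) where

  matchingEdge : Fin a → Fin (joinV a m) × Fin (joinV a m)
  matchingEdge i = (mv m i zero , mv m i (suc zero))

  spokeEdge : Fin a → Fin 2 → Fin m → Fin (joinV a m) × Fin (joinV a m)
  spokeEdge i b j = (mv m i b , iv a j)

  spokes : Fin a → List (Fin (joinV a m) × Fin (joinV a m))
  spokes i = concatMap (λ b → map (spokeEdge i b) (allFin m)) (allFin 2)

  matchingEdge-∈ : ∀ i → matchingEdge i ∈ joinEdges a m
  matchingEdge-∈ i = ∈P.∈-++⁺ˡ (∈P.∈-map⁺ matchingEdge (∈P.∈-allFin i))

  spokeEdge-∈ : ∀ i b j → spokeEdge i b j ∈ joinEdges a m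
  spokeEdge-∈ i b j = ∈P.∈-++⁺ʳ (map matchingEdge (allFin a)) (∈P.∈-concatMap⁺ spokes (Any.map (λ { refl →
    ∈P.∈-concatMap⁺ (λ b → map (spokeEdge i b) (allFin m))
      (Any.map (λ { refl → ∈P.∈-map⁺ (spokeEdge i b) (∈P.∈-allFin j) }) (∈P.∈-allFin b)) })
    (∈P.∈-allFin i)))

  ∈-joinEdges⁻ : ∀ {e} → e ∈ joinEdges a m →
    (∃ λ i → e ≡ matchingEdge i) ⊎ (∃ λ i → ∃ λ b → ∃ λ j → e ≡ spokeEdge i b j)
  ∈-joinEdges⁻ e∈ with ∈P.∈-++⁻ (map matchingEdge (allFin a)) e∈
  ... | inj₁ e∈M with i , _ , refl ← ∈P.∈-map⁻ matchingEdge e∈M = inj₁ (i , refl)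
  ... | inj₂ e∈S
    with i , e∈i ← Any.satisfied (∈P.∈-concatMap⁻ spokes {xs = allFin a} e∈S)
    with b , e∈b ← Any.satisfied (∈P.∈-concatMap⁻ (λ b → map (spokeEdge i b) (allFin m)) {xs = allFin 2} e∈i)
    with j , _ , refl ← ∈P.∈-map⁻ (spokeEdge i b) e∈b = inj₂ (i , b , j , refl)

  length-joinEdges : length (joinEdges a m) ≡ a + a * (2 * m)
  length-joinEdges = begin
    length (map matchingEdge (allFin a) ++ concatMap spokes (allFin a))
      ≡⟨ ListP.length-++ (map matchingEdge (allFin a)) ⟩
    length (map matchingEdge (allFin a)) + length (concatMap spokes (allFin a))
      ≡⟨ cong₂ _+_ (trans (ListP.length-map matchingEdge (allFin a)) (length-allFin a))
                   (trans (length-concatMap spokes (allFin a)) (sum-map-allFin {a} (length ∘ spokes))) ⟩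
    a + ∑[ i < a ] length (spokes i)
      ≡⟨ cong (a +_) (trans (sum-cong-≗ {a} spokes-length) (∑-const a (2 * m))) ⟩
    a + a * (2 * m) ∎
    where
    row : ∀ i b → length (map (spokeEdge i b) (allFin m)) ≡ m
    row i b = trans (ListP.length-map (spokeEdge i b) (allFin m)) (length-allFin m)
    spokes-length : ∀ i → length (spokes i) ≡ 2 * m
    spokes-length i = trans (length-concatMap (λ b → map (spokeEdge i b) (allFin m)) (allFin 2))
                            (cong₂ (λ x y → x + (y + 0)) (row i zero) (row i (suc zero)))

  Join : Graph
  Join = record { V = joinV a m ; E = joinEdges a m }

  vertex-elim : ∀ {c} (Pr : Fin (c * joinV a m) → Set) →
    (∀ k i b → Pr (combine k (mv m i b))) → (∀ k j → Pr (combine k (iv a j))) → ∀ u → Pr u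
  vertex-elim {c} Pr onMatching onIndependent u with k , w , refl ← FinP.combine-surjective {c} {joinV a m} u
    with splitAt (a * 2) w in eq
  ... | inj₁ x with i , b , refl ← FinP.combine-surjective {a} {2} x =
    subst (Pr ∘ combine k) (FinP.splitAt⁻¹-↑ˡ eq) (onMatching k i b)
  ... | inj₂ j = subst (Pr ∘ combine k) (FinP.splitAt⁻¹-↑ʳ eq) (onIndependent k j)

  edge-elim : ∀ {c} (Pr : Fin (c * joinV a m) × Fin (c * joinV a m) → Set) →
    (∀ k i → Pr (liftEdge k (matchingEdge i))) → (∀ k i b j → Pr (liftEdge k (spokeEdge i b j))) →
    ∀ {e} → e ∈ E (copies c Join) → Pr e
  edge-elim {c} Pr onMatching onSpoke e∈ with k , e′ , e′∈ , refl ← ∈-copies⁻ {c} Join e∈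
    with ∈-joinEdges⁻ e′∈
  ... | inj₁ (i , refl) = onMatching k i
  ... | inj₂ (i , b , j , refl) = onSpoke k i b j

  does-mv-mv : ∀ (i i′ : Fin a) (b b′ : Fin 2) →
    does (mv m i b ≟ mv m i′ b′) ≡ does (i ≟ i′) ∧ does (b ≟ b′)
  does-mv-mv i i′ b b′ =
    trans (does-injective {f = _↑ˡ m} (λ {x} {y} → FinP.↑ˡ-injective m x y) (combine i b) (combine i′ b′))
          (does-combine i i′ b b′)

  does-mv-iv : ∀ (i : Fin a) (b : Fin 2) (j : Fin m) → does (mv m i b ≟ iv a j) ≡ false
  does-mv-iv i b j = dec-false (mv m i b ≟ iv a j) (↑ˡ≢↑ʳ (a * 2) (combine i b) j)

  does-iv-mv : ∀ (i : Fin a) (b : Fin 2) (j : Fin m) → does (iv a j ≟ mv m i b) ≡ false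
  does-iv-mv i b j = dec-false (iv a j ≟ mv m i b) (↑ˡ≢↑ʳ (a * 2) (combine i b) j ∘ sym)

  does-iv-iv : ∀ (j j′ : Fin m) → does (iv a j ≟ iv a j′) ≡ does (j ≟ j′)
  does-iv-iv = does-injective {f = (a * 2) ↑ʳ_} (λ {x} {y} → FinP.↑ʳ-injective (a * 2) x y)

  incident-mv-matchingEdge : ∀ (i′ : Fin a) (b′ : Fin 2) i →
    incident (mv m i′ b′) (matchingEdge i) ≡ does (i′ ≟ i)
  incident-mv-matchingEdge i′ b′ i = begin
    incident (mv m i′ b′) (matchingEdge i)
      ≡⟨ incident-does (mv m i′ b′) (matchingEdge i) ⟩
    does (mv m i′ b′ ≟ mv m i zero) ∨ does (mv m i′ b′ ≟ mv m i (suc zero))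
      ≡⟨ cong₂ _∨_ (does-mv-mv i′ i b′ zero) (does-mv-mv i′ i b′ (suc zero)) ⟩
    (does (i′ ≟ i) ∧ does (b′ ≟ zero)) ∨ (does (i′ ≟ i) ∧ does (b′ ≟ suc zero))
      ≡⟨ BoolP.∧-distribˡ-∨ (does (i′ ≟ i)) _ _ ⟨
    does (i′ ≟ i) ∧ (does (b′ ≟ zero) ∨ does (b′ ≟ suc zero))
      ≡⟨ cong (does (i′ ≟ i) ∧_) (either-side b′) ⟩
    does (i′ ≟ i) ∧ true
      ≡⟨ BoolP.∧-identityʳ _ ⟩
    does (i′ ≟ i) ∎
    where
    either-side : ∀ (b : Fin 2) → does (b ≟ zero) ∨ does (b ≟ suc zero) ≡ true
    either-side zero = refl
    either-side (suc zero) = refl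

  incident-mv-spokeEdge : ∀ (i′ : Fin a) (b′ : Fin 2) i b j →
    incident (mv m i′ b′) (spokeEdge i b j) ≡ does (i′ ≟ i) ∧ does (b′ ≟ b)
  incident-mv-spokeEdge i′ b′ i b j = begin
    incident (mv m i′ b′) (spokeEdge i b j)
      ≡⟨ incident-does (mv m i′ b′) (spokeEdge i b j) ⟩
    does (mv m i′ b′ ≟ mv m i b) ∨ does (mv m i′ b′ ≟ iv a j)
      ≡⟨ cong₂ _∨_ (does-mv-mv i′ i b′ b) (does-mv-iv i′ b′ j) ⟩
    (does (i′ ≟ i) ∧ does (b′ ≟ b)) ∨ false
      ≡⟨ BoolP.∨-identityʳ _ ⟩
    does (i′ ≟ i) ∧ does (b′ ≟ b) ∎

  incident-iv-matchingEdge : ∀ (j′ : Fin m) i → incident (iv a j′) (matchingEdge i) ≡ false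
  incident-iv-matchingEdge j′ i =
    trans (incident-does (iv a j′) (matchingEdge i))
          (cong₂ _∨_ (does-iv-mv i zero j′) (does-iv-mv i (suc zero) j′))

  incident-iv-spokeEdge : ∀ (j′ : Fin m) i b j → incident (iv a j′) (spokeEdge i b j) ≡ does (j′ ≟ j)
  incident-iv-spokeEdge j′ i b j =
    trans (incident-does (iv a j′) (spokeEdge i b j))
          (cong₂ _∨_ (does-iv-mv i b j′) (does-iv-iv j′ j))

  incidentSum-joinEdges : ∀ ω (w : Fin (joinV a m)) → incidentSum ω w (joinEdges a m) ≡
    ∑[ i < a ] weightAt ω w (matchingEdge i) + ∑[ i < a ] ∑[ b < 2 ] ∑[ j < m ] weightAt ω w (spokeEdge i b j)
  incidentSum-joinEdges ω w = begin
    sum (map (weightAt ω w) (map matchingEdge (allFin a) ++ concatMap spokes (allFin a)))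
      ≡⟨ cong sum (ListP.map-++ (weightAt ω w) (map matchingEdge (allFin a)) _) ⟩
    sum (map (weightAt ω w) (map matchingEdge (allFin a)) ++ map (weightAt ω w) (concatMap spokes (allFin a)))
      ≡⟨ SumP.sum-++ (map (weightAt ω w) (map matchingEdge (allFin a))) _ ⟩
    sum (map (weightAt ω w) (map matchingEdge (allFin a))) + sum (map (weightAt ω w) (concatMap spokes (allFin a)))
      ≡⟨ cong₂ _+_ (sum-map-map-allFin (weightAt ω w) matchingEdge) spokeSum ⟩
    ∑[ i < a ] weightAt ω w (matchingEdge i) + ∑[ i < a ] ∑[ b < 2 ] ∑[ j < m ] weightAt ω w (spokeEdge i b j) ∎
    where
    spokeSum : sum (map (weightAt ω w) (concatMap spokes (allFin a)))
             ≡ ∑[ i < a ] ∑[ b < 2 ] ∑[ j < m ] weightAt ω w (spokeEdge i b j)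
    spokeSum = begin
      sum (map (weightAt ω w) (concatMap spokes (allFin a)))
        ≡⟨ sum-map-concatMap (weightAt ω w) spokes (allFin a) ⟩
      sum (map (λ i → sum (map (weightAt ω w) (spokes i))) (allFin a))
        ≡⟨ sum-map-allFin {a} _ ⟩
      ∑[ i < a ] sum (map (weightAt ω w) (spokes i))
        ≡⟨ sum-cong-≗ (λ i → trans (sum-map-concatMap (weightAt ω w) (λ b → map (spokeEdge i b) (allFin m))
                                                         (allFin 2))
                         (trans (sum-map-allFin (λ b → sum (map (weightAt ω w) (map (spokeEdge i b) (allFin m)))))
                                (sum-cong-≗ (λ b → sum-map-map-allFin (weightAt ω w) (spokeEdge i b))))) ⟩
      ∑[ i < a ] ∑[ b < 2 ] ∑[ j < m ] weightAt ω w (spokeEdge i b j) ∎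

  incidentSum-mv : ∀ ω (i : Fin a) (b : Fin 2) →
    incidentSum ω (mv m i b) (joinEdges a m) ≡ ω (matchingEdge i) + ∑[ j < m ] ω (spokeEdge i b j)
  incidentSum-mv ω i b = trans (incidentSum-joinEdges ω (mv m i b)) (cong₂ _+_ matching spokeTerms)
    where
    matching : ∑[ i′ < a ] weightAt ω (mv m i b) (matchingEdge i′) ≡ ω (matchingEdge i)
    matching = trans (sum-cong-≗ (λ i′ → weightAt-incident ω (mv m i b) (matchingEdge i′)
                                                             (incident-mv-matchingEdge i b i′)))
                     (∑-delta i (ω ∘ matchingEdge))
    spokeTerms : ∑[ i′ < a ] ∑[ b′ < 2 ] ∑[ j < m ] weightAt ω (mv m i b) (spokeEdge i′ b′ j)
           ≡ ∑[ j < m ] ω (spokeEdge i b j)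
    spokeTerms = begin
      ∑[ i′ < a ] ∑[ b′ < 2 ] ∑[ j < m ] weightAt ω (mv m i b) (spokeEdge i′ b′ j)
        ≡⟨ sum-cong-≗ (λ i′ → sum-cong-≗ (λ b′ → sum-cong-≗ (λ j →
             trans (weightAt-incident ω (mv m i b) (spokeEdge i′ b′ j) (incident-mv-spokeEdge i b i′ b′ j))
                   (if-∧ (does (i ≟ i′)) (does (b ≟ b′)) _)))) ⟩
      ∑[ i′ < a ] ∑[ b′ < 2 ] ∑[ j < m ]
        (if does (i ≟ i′) then (if does (b ≟ b′) then ω (spokeEdge i′ b′ j) else 0) else 0)
        ≡⟨ sum-cong-≗ (λ i′ → trans (sum-cong-≗ (λ b′ → ∑-if (does (i ≟ i′)) (spoke i′ b′)))
                                     (∑-if (does (i ≟ i′)) (λ b′ → ∑[ j < m ] spoke i′ b′ j))) ⟩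
      ∑[ i′ < a ] (if does (i ≟ i′) then ∑[ b′ < 2 ] ∑[ j < m ]
                     (if does (b ≟ b′) then ω (spokeEdge i′ b′ j) else 0) else 0)
        ≡⟨ ∑-delta i (λ i′ → ∑[ b′ < 2 ] ∑[ j < m ] spoke i′ b′ j) ⟩
      ∑[ b′ < 2 ] ∑[ j < m ] (if does (b ≟ b′) then ω (spokeEdge i b′ j) else 0)
        ≡⟨ sum-cong-≗ (λ b′ → ∑-if (does (b ≟ b′)) (λ j → ω (spokeEdge i b′ j))) ⟩
      ∑[ b′ < 2 ] (if does (b ≟ b′) then ∑[ j < m ] ω (spokeEdge i b′ j) else 0)
        ≡⟨ ∑-delta b (λ b′ → ∑[ j < m ] ω (spokeEdge i b′ j)) ⟩
      ∑[ j < m ] ω (spokeEdge i b j) ∎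
      where
      spoke : Fin a → Fin 2 → Fin m → ℕ
      spoke i′ b′ j = if does (b ≟ b′) then ω (spokeEdge i′ b′ j) else 0

  incidentSum-iv : ∀ ω (j : Fin m) →
    incidentSum ω (iv a j) (joinEdges a m) ≡ ∑[ i < a ] ∑[ b < 2 ] ω (spokeEdge i b j)
  incidentSum-iv ω j = trans (incidentSum-joinEdges ω (iv a j)) (cong₂ _+_ matching spokeTerms)
    where
    matching : ∑[ i < a ] weightAt ω (iv a j) (matchingEdge i) ≡ 0
    matching = trans (sum-cong-≗ (λ i → weightAt-incident ω (iv a j) (matchingEdge i) (incident-iv-matchingEdge j i)))
                     (∑-if false (ω ∘ matchingEdge))
    spokeTerms : ∑[ i < a ] ∑[ b < 2 ] ∑[ j′ < m ] weightAt ω (iv a j) (spokeEdge i b j′)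
           ≡ ∑[ i < a ] ∑[ b < 2 ] ω (spokeEdge i b j)
    spokeTerms = sum-cong-≗ (λ i → sum-cong-≗ (λ b →
      trans (sum-cong-≗ (λ j′ → weightAt-incident ω (iv a j) (spokeEdge i b j′) (incident-iv-spokeEdge j i b j′)))
            (∑-delta j (λ j′ → ω (spokeEdge i b j′)))))

-- A table with constant column sums

m+o≡n⇒m≤n : ∀ {m n} o → m + o ≡ n → m ≤ n
m+o≡n⇒m≤n {m} o refl = ℕP.m≤m+n m o

parity : ∀ x → (∃ λ u → 2 * u ≡ x) ⊎ (∃ λ u → 2 * u + 1 ≡ x)
parity zero = inj₁ (0 , refl)
parity (suc x) with parity x
... | inj₁ (u , refl) = inj₂ (u , ℕP.+-comm (2 * u) 1)
... | inj₂ (u , refl) = inj₁ (suc u , step u)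
  where
  step : ∀ u → 2 * suc u ≡ suc (2 * u + 1)
  step = solve-∀

m+n<2m+1⇒n≤m : ∀ {m n} → m + n < 2 * m + 1 → n ≤ m
m+n<2m+1⇒n≤m {m} {n} lt = ℕP.+-cancelˡ-≤ m n m (ℕP.m<1+n⇒m≤n (subst (m + n <_) (shape m) lt))
  where
  shape : ∀ m → 2 * m + 1 ≡ suc (m + m)
  shape = solve-∀

m≤n⇒∃[o]o+m≡n : ∀ {m n} → m ≤ n → ∃ λ o → o + m ≡ n
m≤n⇒∃[o]o+m≡n {m} m≤n with o , eq ← ℕP.m≤n⇒∃[o]m+o≡n m≤n = o , trans (ℕP.+-comm o m) eq

m<n⇒∃[o]1+o+m≡n : ∀ {m n} → m < n → ∃ λ o → suc (o + m) ≡ n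
m<n⇒∃[o]1+o+m≡n {m} m<n with o , eq ← ℕP.m≤n⇒∃[o]m+o≡n m<n = o , trans (cong suc (ℕP.+-comm o m)) eq

2m<2n+1⇒m≤n : ∀ {m n} → 2 * m < 2 * n + 1 → m ≤ n
2m<2n+1⇒m≤n {m} {n} lt = ℕP.*-cancelˡ-≤ 2 (ℕP.m<1+n⇒m≤n (subst (2 * m <_) (ℕP.+-comm (2 * n) 1) lt))

2m+1<2n+1⇒m<n : ∀ {m n} → 2 * m + 1 < 2 * n + 1 → m < n
2m+1<2n+1⇒m<n {m} {n} lt = ℕP.*-cancelˡ-< 2 m n (ℕP.+-cancelʳ-< 1 (2 * m) (2 * n) lt)

-- With the identity as row 0, row₁ r and row₂ r are the other rows of a 3 × (2r + 1) array
-- whose rows are permutations of 0 … 2r and whose columns all sum to 3r.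
row₁ row₂ : ℕ → ℕ → ℕ
row₁ r k = if does (k ≤? r) then r + k else k ∸ suc r
row₂ r k = if does (k ≤? r) then 2 * (r ∸ k) else 2 * (2 * r ∸ k) + 1

data Half : ℕ → ℕ → Set where
  lower : ∀ k d → Half (k + d) k
  upper : ∀ e d → Half (suc (e + d)) (suc (suc (e + d)) + e)

half : ∀ {r k} → k < 2 * r + 1 → Half r k
half {r} {k} k<c with k ≤? r
... | yes k≤r with d , refl ← ℕP.m≤n⇒∃[o]m+o≡n k≤r = lower k d
... | no k≰r with e , refl ← ℕP.m≤n⇒∃[o]m+o≡n (ℕP.≰⇒> k≰r)
             with d , refl ← ℕP.m≤n⇒∃[o]m+o≡n {suc e} {r}
                               (m+n<2m+1⇒n≤m (subst (_< 2 * r + 1) (sym (ℕP.+-suc r e)) k<c)) = upper e d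

rows-lower : ∀ k d → row₁ (k + d) k ≡ (k + d) + k × row₂ (k + d) k ≡ 2 * d
rows-lower k d rewrite dec-true (k ≤? k + d) (ℕP.m≤m+n k d) = refl , cong (2 *_) (ℕP.m+n∸m≡n k d)

rows-upper : ∀ e d → row₁ (suc (e + d)) (suc (suc (e + d)) + e) ≡ e
                   × row₂ (suc (e + d)) (suc (suc (e + d)) + e) ≡ 2 * d + 1
rows-upper e d rewrite dec-false (suc (suc (e + d)) + e ≤? suc (e + d))
                                 (ℕP.<⇒≱ (ℕP.m≤m+n (suc (suc (e + d))) e)) =
  ℕP.m+n∸m≡n (suc (suc (e + d))) e ,
  cong (λ x → 2 * x + 1) (trans (cong (_∸ (suc (suc (e + d)) + e)) (shape e d))
                                (ℕP.m+n∸m≡n (suc (suc (e + d)) + e) d))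
  where
  shape : ∀ e d → 2 * suc (e + d) ≡ (suc (suc (e + d)) + e) + d
  shape = solve-∀

rows-sum : ∀ {r k} → k < 2 * r + 1 → k + row₁ r k + row₂ r k ≡ 3 * r
rows-sum {r} {k} k<c with half {r} {k} k<c
... | lower k d = trans (cong₂ (λ x y → k + x + y) (proj₁ (rows-lower k d)) (proj₂ (rows-lower k d))) (total k d)
  where
  total : ∀ k d → k + ((k + d) + k) + 2 * d ≡ 3 * (k + d)
  total = solve-∀
... | upper e d = trans (cong₂ (λ x y → suc (suc (e + d)) + e + x + y)
                               (proj₁ (rows-upper e d)) (proj₂ (rows-upper e d)))
                        (total e d)
  where
  total : ∀ e d → (suc (suc (e + d)) + e) + e + (2 * d + 1) ≡ 3 * suc (e + d)
  total = solve-∀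

row₁-< : ∀ {r k} → k < 2 * r + 1 → row₁ r k < 2 * r + 1
row₁-< {r} {k} k<c with half {r} {k} k<c
... | lower k d = subst (_< 2 * (k + d) + 1) (sym (proj₁ (rows-lower k d))) (m+o≡n⇒m≤n d (shape k d))
  where
  shape : ∀ k d → suc ((k + d) + k) + d ≡ 2 * (k + d) + 1
  shape = solve-∀
... | upper e d = subst (_< 2 * suc (e + d) + 1) (sym (proj₁ (rows-upper e d))) (m+o≡n⇒m≤n (e + 2 * d + 2) (shape e d))
  where
  shape : ∀ e d → suc e + (e + 2 * d + 2) ≡ 2 * suc (e + d) + 1
  shape = solve-∀

row₂-< : ∀ {r k} → k < 2 * r + 1 → row₂ r k < 2 * r + 1
row₂-< {r} {k} k<c with half {r} {k} k<c
... | lower k d = subst (_< 2 * (k + d) + 1) (sym (proj₂ (rows-lower k d))) (m+o≡n⇒m≤n (2 * k) (shape k d))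
  where
  shape : ∀ k d → suc (2 * d) + 2 * k ≡ 2 * (k + d) + 1
  shape = solve-∀
... | upper e d = subst (_< 2 * suc (e + d) + 1) (sym (proj₂ (rows-upper e d))) (m+o≡n⇒m≤n (2 * e + 1) (shape e d))
  where
  shape : ∀ e d → suc (2 * d + 1) + (2 * e + 1) ≡ 2 * suc (e + d) + 1
  shape = solve-∀

row₁-surjective : ∀ {r ρ} → ρ < 2 * r + 1 → ∃ λ k → k < 2 * r + 1 × row₁ r k ≡ ρ
row₁-surjective {r} {ρ} ρ<c with ρ <? r
... | yes ρ<r with d , refl ← ℕP.m≤n⇒∃[o]m+o≡n ρ<r =
  suc (suc (ρ + d)) + ρ , m+o≡n⇒m≤n d (shape ρ d) , proj₁ (rows-upper ρ d)
  where
  shape : ∀ ρ d → suc (suc (suc (ρ + d)) + ρ) + d ≡ 2 * suc (ρ + d) + 1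
  shape = solve-∀
... | no ρ≮r with k , refl ← ℕP.m≤n⇒∃[o]m+o≡n (ℕP.≮⇒≥ ρ≮r)
             with d , refl ← ℕP.m≤n⇒∃[o]m+o≡n {k} {r} (m+n<2m+1⇒n≤m ρ<c) =
  k , m+o≡n⇒m≤n (k + 2 * d) (shape k d) , proj₁ (rows-lower k d)
  where
  shape : ∀ k d → suc k + (k + 2 * d) ≡ 2 * (k + d) + 1
  shape = solve-∀

row₂-surjective : ∀ {r ρ} → ρ < 2 * r + 1 → ∃ λ k → k < 2 * r + 1 × row₂ r k ≡ ρ
row₂-surjective {r} {ρ} ρ<c with parity ρ
... | inj₁ (u , refl) with k , refl ← m≤n⇒∃[o]o+m≡n {u} {r} (2m<2n+1⇒m≤n ρ<c) =
  k , m+o≡n⇒m≤n (k + 2 * u) (shape k u) , proj₂ (rows-lower k u)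
  where
  shape : ∀ k u → suc k + (k + 2 * u) ≡ 2 * (k + u) + 1
  shape = solve-∀
... | inj₂ (u , refl) with e , refl ← m<n⇒∃[o]1+o+m≡n {u} {r} (2m+1<2n+1⇒m<n ρ<c) =
  suc (suc (e + u)) + e , m+o≡n⇒m≤n u (shape e u) , proj₂ (rows-upper e u)
  where
  shape : ∀ e u → suc (suc (suc (e + u)) + e) + u ≡ 2 * suc (e + u) + 1
  shape = solve-∀

module Table (r : ℕ) where

  c : ℕ
  c = 2 * r + 1

  restrict : (f : ℕ → ℕ) → (∀ {k} → k < c → f k < c) → Fin c → Fin c
  restrict f f< k = fromℕ< (f< (FinP.toℕ<n k))

  restrict-surjective : ∀ f (f< : ∀ {k} → k < c → f k < c) →
    (∀ {ρ} → ρ < c → ∃ λ k → k < c × f k ≡ ρ) → StrictlySurjective _≡_ (restrict f f<)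
  restrict-surjective f f< f-surj y with k , k<c , fk≡y ← f-surj (FinP.toℕ<n y) =
    fromℕ< k<c ,
    FinP.toℕ-injective (trans (FinP.toℕ-fromℕ< _) (trans (cong f (FinP.toℕ-fromℕ< k<c)) fk≡y))

  column : ℕ → Fin c → Fin c
  column 0 = id
  column 1 = restrict (row₁ r) row₁-<
  column 2 = restrict (row₂ r) row₂-<
  column 3 = id
  column 4 = opposite
  column (suc (suc (suc (suc (suc i))))) = column (suc (suc (suc i)))

  column-surjective : ∀ i → StrictlySurjective _≡_ (column i)
  column-surjective 0 y = y , refl
  column-surjective 1 = restrict-surjective (row₁ r) row₁-< row₁-surjective
  column-surjective 2 = restrict-surjective (row₂ r) row₂-< row₂-surjective
  column-surjective 3 y = y , refl
  column-surjective 4 y = opposite y , FinP.opposite-involutive y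
  column-surjective (suc (suc (suc (suc (suc i))))) = column-surjective (suc (suc (suc i)))

  alternating-sum : ∀ u k → ∑[ i < u + u ] toℕ (column (3 + toℕ i) k) ≡ u * (r + r)
  alternating-sum zero k = refl
  alternating-sum (suc u) k = begin
    ∑[ i < suc u + suc u ] toℕ (column (3 + toℕ i) k)
      ≡⟨ cong (λ x → ∑[ i < suc x ] toℕ (column (3 + toℕ i) k)) (ℕP.+-suc u u) ⟩
    toℕ k + (toℕ (opposite k) + ∑[ i < u + u ] toℕ (column (3 + toℕ i) k))
      ≡⟨ ℕP.+-assoc (toℕ k) _ _ ⟨
    (toℕ k + toℕ (opposite k)) + ∑[ i < u + u ] toℕ (column (3 + toℕ i) k)
      ≡⟨ cong₂ _+_ (toℕ+toℕ-opposite {r} k) (alternating-sum u k) ⟩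
    r + r + u * (r + r) ∎

  column-sum : ∀ t k → ∑[ i < 2 * suc t + 1 ] toℕ (column (toℕ i) k) ≡ (2 * suc t + 1) * r
  column-sum t k = begin
    ∑[ i < 2 * suc t + 1 ] toℕ (column (toℕ i) k)
      ≡⟨ cong (λ x → ∑[ i < x ] toℕ (column (toℕ i) k)) (three+ t) ⟩
    toℕ k + (toℕ (column 1 k) + (toℕ (column 2 k) + rest))
      ≡⟨ cong₂ (λ x y → toℕ k + (x + (y + rest)))
              (FinP.toℕ-fromℕ< (row₁-< (FinP.toℕ<n k))) (FinP.toℕ-fromℕ< (row₂-< (FinP.toℕ<n k))) ⟩
    toℕ k + (row₁ r (toℕ k) + (row₂ r (toℕ k) + rest))
      ≡⟨ reassociate (toℕ k) _ _ rest ⟩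
    (toℕ k + row₁ r (toℕ k) + row₂ r (toℕ k)) + rest
      ≡⟨ cong₂ _+_ (rows-sum (FinP.toℕ<n k)) (alternating-sum t k) ⟩
    3 * r + t * (r + r)
      ≡⟨ total t r ⟩
    (2 * suc t + 1) * r ∎
    where
    rest = ∑[ i < t + t ] toℕ (column (3 + toℕ i) k)
    three+ : ∀ t → 2 * suc t + 1 ≡ 3 + (t + t)
    three+ = solve-∀
    reassociate : ∀ x y z w → x + (y + (z + w)) ≡ x + y + z + w
    reassociate = solve-∀
    total : ∀ t r → 3 * r + t * (r + r) ≡ (2 * suc t + 1) * r
    total = solve-∀

  cell : ∀ {a} → Fin c → Fin a → Fin (a * c)
  cell k i = combine i (column (toℕ i) k)

  cell-surjective : ∀ {a} (w : Fin (a * c)) → ∃ λ k → ∃ λ i → cell {a} k i ≡ w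
  cell-surjective {a} w with i , ρ , refl ← FinP.combine-surjective {a} {c} w
                    with k , refl ← column-surjective (toℕ i) ρ = k , i , refl

  cell-sum : ∀ t k → 2 * ∑[ i < 2 * suc t + 1 ] toℕ (cell k i) + (2 * suc t + 1)
                     ≡ (2 * suc t + 1) * ((2 * suc t + 1) * c)
  cell-sum t k = begin
    2 * ∑[ i < a ] toℕ (cell k i) + a
      ≡⟨ cong (λ x → 2 * x + a) cells ⟩
    2 * (c * ∑[ i < a ] toℕ i + a * r) + a
      ≡⟨ regroup r a (∑[ i < a ] toℕ i) ⟩
    c * (2 * ∑[ i < a ] toℕ i + a)
      ≡⟨ cong (c *_) (∑-toℕ a) ⟩
    c * (a * a)
      ≡⟨ rotate c a ⟩
    a * (a * c) ∎
    where
    a = 2 * suc t + 1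
    cells : ∑[ i < a ] toℕ (cell k i) ≡ c * ∑[ i < a ] toℕ i + a * r
    cells = begin
      ∑[ i < a ] toℕ (cell k i)
        ≡⟨ sum-cong-≗ {a} (λ i → FinP.toℕ-combine i (column (toℕ i) k)) ⟩
      ∑[ i < a ] (c * toℕ i + toℕ (column (toℕ i) k))
        ≡⟨ ∑-distrib-+ {a} (λ i → c * toℕ i) (λ i → toℕ (column (toℕ i) k)) ⟩
      ∑[ i < a ] (c * toℕ i) + ∑[ i < a ] toℕ (column (toℕ i) k)
        ≡⟨ cong₂ _+_ (∑-*ˡ {a} c toℕ) (column-sum t k) ⟩
      c * ∑[ i < a ] toℕ i + a * r ∎
    regroup : ∀ r a S → 2 * ((2 * r + 1) * S + a * r) + a ≡ (2 * r + 1) * (2 * S + a)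
    regroup = solve-∀
    rotate : ∀ c a → c * (a * a) ≡ a * (a * c)
    rotate = solve-∀

-- Arithmetic of the vertex sums

residue-≢ : ∀ {ρ} q p K .{{_ : ℕ.NonZero K}} → 0 < ρ → ρ < K → ρ + q * K ≢ p * K
residue-≢ {ρ} q p K 0<ρ ρ<K eq = ℕP.<⇒≢ 0<ρ (sym (begin
  ρ                ≡⟨ m<n⇒m%n≡m ρ<K ⟨
  ρ % K            ≡⟨ [m+kn]%n≡m%n ρ q K ⟨
  (ρ + q * K) % K  ≡⟨ cong (_% K) eq ⟩
  (p * K) % K      ≡⟨ m*n%n≡0 p K ⟩
  0                ∎))

below⇒above : ∀ {x y n} → x + y ≡ n + n → x < n → n < y
below⇒above eq x<n = ℕP.≰⇒> λ y≤n → ℕP.<-irrefl eq (ℕP.+-mono-<-≤ x<n y≤n)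

above⇒below : ∀ {x y n} → x + y ≡ n + n → n < x → y < n
above⇒below eq n<x = ℕP.≰⇒> λ n≤y → ℕP.<-irrefl (sym eq) (ℕP.+-mono-<-≤ n<x n≤y)

-- The identities below keep P a variable, tied to h by suc (x + x′) ≡ P with x, x′ the values of h
-- and opposite h, and are stated in the shape that toℕ-combine and sums over Fin 2 produce.
matching-identity : ∀ n β x x′ {P} → suc (x + x′) ≡ P →
  suc ((2 * n + 1) * (2 * P) + x′)
    + (2 * n + 1 + (2 * P * (n * (2 * n + 1)) + ((2 * n + 1) * (P * β) + (n * x′ + suc n * x))))
  ≡ suc n * (suc ((2 * n + 1) * (2 * P)) + P) + β * ((2 * n + 1) * P)
matching-identity n β x x′ refl = identity n β x x′
  where
  identity : ∀ n β x x′ →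
    suc ((2 * n + 1) * (2 * suc (x + x′)) + x′)
      + (2 * n + 1 + (2 * suc (x + x′) * (n * (2 * n + 1))
         + ((2 * n + 1) * (suc (x + x′) * β) + (n * x′ + suc n * x))))
    ≡ suc n * (suc ((2 * n + 1) * (2 * suc (x + x′))) + suc (x + x′)) + β * ((2 * n + 1) * suc (x + x′))
  identity = solve-∀

pair-identity : ∀ j j′ y z {P} → suc (y + z) ≡ P →
  suc (2 * P * j + (P * 0 + y)) + (suc (2 * P * j′ + (P * 1 + z)) + 0) ≡ suc (suc (j + j′) * (2 * P))
pair-identity j j′ y z refl = identity j j′ y z
  where
  identity : ∀ j j′ y z →
    suc (2 * suc (y + z) * j + (suc (y + z) * 0 + y)) + (suc (2 * suc (y + z) * j′ + (suc (y + z) * 1 + z)) + 0)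
    ≡ suc (suc (j + j′) * (2 * suc (y + z)))
  identity = solve-∀

centre-identity : ∀ a P n S → 2 * S + a ≡ a * P →
  a * (2 + 4 * P * n + P) + 2 * S ≡ a * suc ((2 * n + 1) * (2 * P))
centre-identity a P n S eq = begin
  a * (2 + 4 * P * n + P) + 2 * S   ≡⟨ regroup a P n S ⟩
  a * (1 + 4 * P * n + P) + (2 * S + a)   ≡⟨ cong (a * (1 + 4 * P * n + P) +_) eq ⟩
  a * (1 + 4 * P * n + P) + a * P   ≡⟨ total a P n ⟩
  a * suc ((2 * n + 1) * (2 * P)) ∎
  where
  regroup : ∀ a P n S → a * (2 + 4 * P * n + P) + 2 * S ≡ a * (1 + 4 * P * n + P) + (2 * S + a)
  regroup = solve-∀
  total : ∀ a P n → a * (1 + 4 * P * n + P) + a * P ≡ a * suc ((2 * n + 1) * (2 * P))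
  total = solve-∀

matching≢multiple : ∀ n P a β → 0 < P → β ≤ 1 →
  suc n * (suc ((2 * n + 1) * (2 * P)) + P) + β * ((2 * n + 1) * P) ≢ a * suc ((2 * n + 1) * (2 * P))
matching≢multiple n P a β 0<P β≤1 eq =
  residue-≢ (suc n) a (suc ((2 * n + 1) * (2 * P))) 0<R (s≤s R≤Q) (trans (regroup n P β) eq)
  where
  regroup : ∀ n P β → (suc n * P + β * ((2 * n + 1) * P)) + suc n * suc ((2 * n + 1) * (2 * P))
                      ≡ suc n * (suc ((2 * n + 1) * (2 * P)) + P) + β * ((2 * n + 1) * P)
  regroup = solve-∀
  0<R : 0 < suc n * P + β * ((2 * n + 1) * P)
  0<R = ℕP.<-≤-trans 0<P (ℕP.≤-trans (ℕP.m≤m+n P (n * P)) (ℕP.m≤m+n (suc n * P) _))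
  R≤Q : suc n * P + β * ((2 * n + 1) * P) ≤ (2 * n + 1) * (2 * P)
  R≤Q = ℕP.≤-trans (ℕP.+-monoʳ-≤ (suc n * P) (ℕP.*-monoˡ-≤ ((2 * n + 1) * P) β≤1))
                   (m+o≡n⇒m≤n (n * P) (shape n P))
    where
    shape : ∀ n P → suc n * P + 1 * ((2 * n + 1) * P) + n * P ≡ (2 * n + 1) * (2 * P)
    shape = solve-∀

-- The labeling

module Construction (n r t : ℕ) where

  open Table r

  a m P Q : ℕ
  a = 2 * suc t + 1
  m = 2 * n + 1
  P = a * c
  Q = m * (2 * P)

  open JoinGraph a m

  G : Graph
  G = copies c Join

  data Vertex : Set where
    matching    : Fin c → Fin a → Fin 2 → Vertex
    independent : Fin c → Fin m → Vertex

  inCopy : Fin c → Fin (a * 2) ⊎ Fin m → Vertex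
  inCopy k (inj₁ x) = matching k (proj₁ (remQuot {a} 2 x)) (proj₂ (remQuot {a} 2 x))
  inCopy k (inj₂ j) = independent k j

  vertex : Fin (V G) → Vertex
  vertex u = inCopy (proj₁ (remQuot {c} (joinV a m) u)) (splitAt (a * 2) (proj₂ (remQuot {c} (joinV a m) u)))

  vertex-mv : ∀ k i b → vertex (combine k (mv m i b)) ≡ matching k i b
  vertex-mv k i b = begin
    vertex (combine k (mv m i b))
      ≡⟨ cong (λ p → inCopy (proj₁ p) (splitAt (a * 2) (proj₂ p))) (FinP.remQuot-combine k (mv m i b)) ⟩
    inCopy k (splitAt (a * 2) (combine i b ↑ˡ m))
      ≡⟨ cong (inCopy k) (FinP.splitAt-↑ˡ (a * 2) (combine i b) m) ⟩
    inCopy k (inj₁ (combine i b))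
      ≡⟨ cong (λ p → matching k (proj₁ p) (proj₂ p)) (FinP.remQuot-combine i b) ⟩
    matching k i b ∎

  vertex-iv : ∀ k j → vertex (combine k (iv a j)) ≡ independent k j
  vertex-iv k j = trans (cong (λ p → inCopy (proj₁ p) (splitAt (a * 2) (proj₂ p))) (FinP.remQuot-combine k (iv a j)))
                        (cong (inCopy k) (FinP.splitAt-↑ʳ (a * 2) m j))

  digit : Fin 2 → Fin m → Fin m
  digit zero = id
  digit (suc zero) = opposite

  digit-involutive : ∀ b j → digit b (digit b j) ≡ j
  digit-involutive zero j = refl
  digit-involutive (suc zero) j = FinP.opposite-involutive j

  ∑-digit : ∀ b (g : Fin m → ℕ) → ∑[ j < m ] g (digit b j) ≡ ∑[ j < m ] g j
  ∑-digit zero g = refl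
  ∑-digit (suc zero) g = ∑-opposite g

  flip : Fin m → Fin P → Fin P
  flip d = if does (toℕ d <? n) then opposite else id

  flip-involutive : ∀ d h → flip d (flip d h) ≡ h
  flip-involutive d h with does (toℕ d <? n)
  ... | true = FinP.opposite-involutive h
  ... | false = refl

  flip-< : ∀ d h → toℕ d < n → flip d h ≡ opposite h
  flip-< d h d<n = cong (λ b → (if b then opposite else id) h) (dec-true (toℕ d <? n) d<n)

  flip-≮ : ∀ d h → ¬ toℕ d < n → flip d h ≡ h
  flip-≮ d h d≮n = cong (λ b → (if b then opposite else id) h) (dec-false (toℕ d <? n) d≮n)

  spokeLabel : Fin c → Fin a → Fin 2 → Fin m → Fin Q
  spokeLabel k i b j = combine (digit b j) (combine b (flip (digit b j) (cell k i)))

  matchingLabel : Fin c → Fin a → ℕ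
  matchingLabel k i = Q + toℕ (opposite (cell k i))

  edgeLabel : Vertex → Vertex → ℕ
  edgeLabel (matching k i _) (matching _ _ _) = matchingLabel k i
  edgeLabel (matching k i b) (independent _ j) = toℕ (spokeLabel k i b j)
  edgeLabel (independent _ _) _ = 0  -- junk: no edge of G starts at an independent vertex

  label : Fin (V G) × Fin (V G) → ℕ
  label (u , v) = edgeLabel (vertex u) (vertex v)

  label-matchingEdge : ∀ k i → label (liftEdge k (matchingEdge i)) ≡ matchingLabel k i
  label-matchingEdge k i = cong₂ edgeLabel (vertex-mv k i zero) (vertex-mv k i (suc zero))

  label-spokeEdge : ∀ k i b j → label (liftEdge k (spokeEdge i b j)) ≡ toℕ (spokeLabel k i b j)
  label-spokeEdge k i b j = cong₂ edgeLabel (vertex-mv k i b) (vertex-iv k j)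

  size-G : size G ≡ Q + P
  size-G = trans (size-copies c Join) (trans (cong (c *_) length-joinEdges) (shape a c m))
    where
    shape : ∀ a c m → c * (a + a * (2 * m)) ≡ m * (2 * (a * c)) + a * c
    shape = solve-∀

  label-< : ∀ {e} → e ∈ E G → label e < size G
  label-< = edge-elim (λ e → label e < size G)
    (λ k i → subst₂ _<_ (sym (label-matchingEdge k i)) (sym size-G)
                        (ℕP.+-monoʳ-< Q (FinP.toℕ<n (opposite (cell k i)))))
    (λ k i b j → subst₂ _<_ (sym (label-spokeEdge k i b j)) (sym size-G)
                            (ℕP.<-≤-trans (FinP.toℕ<n (spokeLabel k i b j)) (ℕP.m≤m+n Q P)))

  labeling : Labeling G
  labeling i = fromℕ< (label-< (∈P.∈-lookup i))

  toℕ-labeling : ∀ i → toℕ (labeling i) ≡ label (lookup (E G) i)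
  toℕ-labeling i = FinP.toℕ-fromℕ< (label-< (∈P.∈-lookup i))

  Hit : ℕ → Set
  Hit v = ∃ λ e → e ∈ E G × label e ≡ v

  spokeLabel-hit : ∀ x → Hit (toℕ x)
  spokeLabel-hit x
    with d , y , refl ← FinP.combine-surjective {m} {2 * P} x
    with b , w , refl ← FinP.combine-surjective {2} {P} y
    with k , i , cki ← cell-surjective {a} (flip d w) =
    liftEdge k (spokeEdge i b (digit b d)) , ∈-copies⁺ Join k (spokeEdge-∈ i b (digit b d)) , (begin
      label (liftEdge k (spokeEdge i b (digit b d)))
        ≡⟨ label-spokeEdge k i b (digit b d) ⟩
      toℕ (combine (digit b (digit b d)) (combine b (flip (digit b (digit b d)) (cell k i))))
        ≡⟨ cong (λ x → toℕ (combine x (combine b (flip x (cell k i))))) (digit-involutive b d) ⟩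
      toℕ (combine d (combine b (flip d (cell k i))))
        ≡⟨ cong (λ x → toℕ (combine d (combine b (flip d x)))) cki ⟩
      toℕ (combine d (combine b (flip d (flip d w))))
        ≡⟨ cong (λ x → toℕ (combine d (combine b x))) (flip-involutive d w) ⟩
      toℕ (combine d (combine b w)) ∎)

  matchingLabel-hit : ∀ w → Hit (Q + toℕ w)
  matchingLabel-hit w with k , i , cki ← cell-surjective {a} (opposite w) =
    liftEdge k (matchingEdge i) , ∈-copies⁺ Join k (matchingEdge-∈ i) , (begin
      label (liftEdge k (matchingEdge i))    ≡⟨ label-matchingEdge k i ⟩
      Q + toℕ (opposite (cell k i))          ≡⟨ cong (λ x → Q + toℕ (opposite x)) cki ⟩
      Q + toℕ (opposite (opposite w))        ≡⟨ cong (λ x → Q + toℕ x) (FinP.opposite-involutive w) ⟩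
      Q + toℕ w ∎)

  label-surjective : ∀ v → v < Q + P → Hit v
  label-surjective v v<q with v <? Q
  ... | yes v<Q = subst Hit (FinP.toℕ-fromℕ< v<Q) (spokeLabel-hit (fromℕ< v<Q))
  ... | no v≮Q with w , refl ← ℕP.m≤n⇒∃[o]m+o≡n (ℕP.≮⇒≥ v≮Q) =
    subst (Hit ∘ (Q +_)) (FinP.toℕ-fromℕ< w<P) (matchingLabel-hit (fromℕ< w<P))
    where
    w<P : w < P
    w<P = ℕP.+-cancelˡ-< Q w P v<q

  labeling-bijective : Bijective _≡_ _≡_ labeling
  labeling-bijective = strictlySurjective⇒bijective hit
    where
    hit : StrictlySurjective _≡_ labeling
    hit y =
      let e , e∈ , ℓe = label-surjective (toℕ y) (subst (toℕ y <_) size-G (FinP.toℕ<n y))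
      in index e∈ , FinP.toℕ-injective
           (trans (toℕ-labeling (index e∈)) (trans (cong label (sym (AnyP.lookup-index e∈))) ℓe))

  spokeValue : Fin 2 → Fin m → Fin P → ℕ
  spokeValue b d h = suc (toℕ (combine d (combine b (flip d h))))

  toℕ-spokeValue : ∀ b d h → spokeValue b d h ≡ suc (2 * P * toℕ d + (P * toℕ b + toℕ (flip d h)))
  toℕ-spokeValue b d h =
    cong suc (trans (FinP.toℕ-combine d (combine b (flip d h))) (cong (2 * P * toℕ d +_) (FinP.toℕ-combine b (flip d h))))

  ∑-flip : ∀ h → ∑[ d < m ] toℕ (flip d h) ≡ n * toℕ (opposite h) + suc n * toℕ h
  ∑-flip h = begin
    ∑[ d < m ] toℕ (flip d h)
      ≡⟨ sum-cong-≗ {m} (λ d → BoolP.if-float (λ (f : Fin P → Fin P) → toℕ (f h)) (does (toℕ d <? n))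
                                              {opposite} {id}) ⟩
    ∑[ d < m ] (if does (toℕ d <? n) then toℕ (opposite h) else toℕ h)
      ≡⟨ cong (λ x → ∑[ d < x ] (if does (toℕ d <? n) then toℕ (opposite h) else toℕ h)) (split n) ⟩
    ∑[ d < n + suc n ] (if does (toℕ d <? n) then toℕ (opposite h) else toℕ h)
      ≡⟨ ∑-if-toℕ< n (suc n) (toℕ (opposite h)) (toℕ h) ⟩
    n * toℕ (opposite h) + suc n * toℕ h ∎
    where
    split : ∀ n → 2 * n + 1 ≡ n + suc n
    split = solve-∀

  matchingValue : Fin 2 → ℕ
  matchingValue b = suc n * (suc Q + P) + toℕ b * (m * P)

  independentValue : ℕ
  independentValue = a * suc Q

  matching-sum : ∀ b h → suc (Q + toℕ (opposite h)) + ∑[ d < m ] spokeValue b d h ≡ matchingValue b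
  matching-sum b h = begin
    suc (Q + toℕ (opposite h)) + ∑[ d < m ] spokeValue b d h
      ≡⟨ cong (suc (Q + toℕ (opposite h)) +_) spokeSum ⟩
    suc (Q + toℕ (opposite h)) + (m + (2 * P * (n * m) + (m * (P * toℕ b) + (n * toℕ (opposite h) + suc n * toℕ h))))
      ≡⟨ matching-identity n (toℕ b) (toℕ h) (toℕ (opposite h)) (toℕ-opposite h) ⟩
    matchingValue b ∎
    where
    spokeSum : ∑[ d < m ] spokeValue b d h
           ≡ m + (2 * P * (n * m) + (m * (P * toℕ b) + (n * toℕ (opposite h) + suc n * toℕ h)))
    spokeSum = begin
      ∑[ d < m ] spokeValue b d h
        ≡⟨ sum-cong-≗ {m} (λ d → toℕ-spokeValue b d h) ⟩
      ∑[ d < m ] suc (2 * P * toℕ d + (P * toℕ b + toℕ (flip d h)))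
        ≡⟨ ∑-affine (2 * P) (P * toℕ b) (λ d → toℕ (flip d h)) ⟩
      m + (2 * P * ∑[ d < m ] toℕ d + (m * (P * toℕ b) + ∑[ d < m ] toℕ (flip d h)))
        ≡⟨ cong₂ (λ S F → m + (2 * P * S + (m * (P * toℕ b) + F))) (∑-toℕ-odd n) (∑-flip h) ⟩
      m + (2 * P * (n * m) + (m * (P * toℕ b) + (n * toℕ (opposite h) + suc n * toℕ h))) ∎

  spokePair : Fin m → Fin P → ℕ
  spokePair j h = spokeValue zero j h + (spokeValue (suc zero) (opposite j) h + 0)

  spokePair-≡ : ∀ j h {x y} → flip j h ≡ x → flip (opposite j) h ≡ y →
    spokePair j h ≡ suc (2 * P * toℕ j + (P * 0 + toℕ x)) + (suc (2 * P * toℕ (opposite j) + (P * 1 + toℕ y)) + 0)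
  spokePair-≡ j h refl refl =
    cong₂ (λ x y → x + (y + 0)) (toℕ-spokeValue zero j h) (toℕ-spokeValue (suc zero) (opposite j) h)

  off-centre-spokePair : ∀ j h → toℕ j ≢ n → spokePair j h ≡ suc Q
  off-centre-spokePair j h j≢n with ℕP.<-cmp (toℕ j) n
  ... | tri< j<n _ _ = begin
    spokePair j h
      ≡⟨ spokePair-≡ j h (flip-< j h j<n) (flip-≮ (opposite j) h (ℕP.<-asym (below⇒above mirror j<n))) ⟩
    suc (2 * P * toℕ j + (P * 0 + toℕ (opposite h))) + (suc (2 * P * toℕ (opposite j) + (P * 1 + toℕ h)) + 0)
      ≡⟨ pair-identity (toℕ j) (toℕ (opposite j)) (toℕ (opposite h)) (toℕ h)
                       (trans (cong suc (ℕP.+-comm (toℕ (opposite h)) (toℕ h))) (toℕ-opposite h)) ⟩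
    suc (suc (toℕ j + toℕ (opposite j)) * (2 * P))
      ≡⟨ cong (λ x → suc (x * (2 * P))) (toℕ-opposite j) ⟩
    suc Q ∎
    where
    mirror = toℕ+toℕ-opposite {n} j
  ... | tri≈ _ j≡n _ = contradiction j≡n j≢n
  ... | tri> _ _ n<j = begin
    spokePair j h
      ≡⟨ spokePair-≡ j h (flip-≮ j h (ℕP.<-asym n<j)) (flip-< (opposite j) h (above⇒below mirror n<j)) ⟩
    suc (2 * P * toℕ j + (P * 0 + toℕ h)) + (suc (2 * P * toℕ (opposite j) + (P * 1 + toℕ (opposite h))) + 0)
      ≡⟨ pair-identity (toℕ j) (toℕ (opposite j)) (toℕ h) (toℕ (opposite h)) (toℕ-opposite h) ⟩
    suc (suc (toℕ j + toℕ (opposite j)) * (2 * P))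
      ≡⟨ cong (λ x → suc (x * (2 * P))) (toℕ-opposite j) ⟩
    suc Q ∎
    where
    mirror = toℕ+toℕ-opposite {n} j

  centre-spokePair : ∀ j h → toℕ j ≡ n → spokePair j h ≡ (2 + 4 * P * n + P) + 2 * toℕ h
  centre-spokePair j h j≡n = begin
    spokePair j h
      ≡⟨ spokePair-≡ j h (flip-≮ j h (ℕP.<-irrefl j≡n)) (flip-≮ (opposite j) h (ℕP.<-irrefl j′≡n)) ⟩
    suc (2 * P * toℕ j + (P * 0 + toℕ h)) + (suc (2 * P * toℕ (opposite j) + (P * 1 + toℕ h)) + 0)
      ≡⟨ cong₂ (λ x y → suc (2 * P * x + (P * 0 + toℕ h)) + (suc (2 * P * y + (P * 1 + toℕ h)) + 0))
               j≡n j′≡n ⟩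
    suc (2 * P * n + (P * 0 + toℕ h)) + (suc (2 * P * n + (P * 1 + toℕ h)) + 0)
      ≡⟨ identity P n (toℕ h) ⟩
    (2 + 4 * P * n + P) + 2 * toℕ h ∎
    where
    j′≡n : toℕ (opposite j) ≡ n
    j′≡n = ℕP.+-cancelˡ-≡ n (toℕ (opposite j)) n
             (trans (cong (_+ toℕ (opposite j)) (sym j≡n)) (toℕ+toℕ-opposite {n} j))
    identity : ∀ P n x → suc (2 * P * n + (P * 0 + x)) + (suc (2 * P * n + (P * 1 + x)) + 0)
                         ≡ (2 + 4 * P * n + P) + 2 * x
    identity = solve-∀

  independent-sum : ∀ k j → ∑[ i < a ] spokePair j (cell k i) ≡ independentValue
  independent-sum k j with toℕ j ℕP.≟ n
  ... | no j≢n = trans (sum-cong-≗ {a} (λ i → off-centre-spokePair j (cell k i) j≢n)) (∑-const a (suc Q))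
  ... | yes j≡n = begin
    ∑[ i < a ] spokePair j (cell k i)
      ≡⟨ sum-cong-≗ {a} (λ i → centre-spokePair j (cell k i) j≡n) ⟩
    ∑[ i < a ] (K + 2 * toℕ (cell k i))
      ≡⟨ ∑-distrib-+ {a} (λ _ → K) (λ i → 2 * toℕ (cell k i)) ⟩
    ∑[ i < a ] K + ∑[ i < a ] (2 * toℕ (cell k i))
      ≡⟨ cong₂ _+_ (∑-const a K) (∑-*ˡ {a} 2 (λ i → toℕ (cell k i))) ⟩
    a * K + 2 * ∑[ i < a ] toℕ (cell k i)
      ≡⟨ centre-identity a P n (∑[ i < a ] toℕ (cell k i)) (cell-sum t k) ⟩
    independentValue ∎
    where
    K = 2 + 4 * P * n + P

  fplus-copy : ∀ k w → fplus G labeling (combine k w) ≡ incidentSum (suc ∘ label ∘ liftEdge k) w (joinEdges a m)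
  fplus-copy k w =
    trans (fplus≡incidentSum G labeling label toℕ-labeling (combine k w)) (incidentSum-copies c Join (suc ∘ label) k w)

  fplus-matching : ∀ k i b → fplus G labeling (combine k (mv m i b)) ≡ matchingValue b
  fplus-matching k i b = begin
    fplus G labeling (combine k (mv m i b))
      ≡⟨ fplus-copy k (mv m i b) ⟩
    incidentSum (suc ∘ label ∘ liftEdge k) (mv m i b) (joinEdges a m)
      ≡⟨ incidentSum-mv (suc ∘ label ∘ liftEdge k) i b ⟩
    suc (label (liftEdge k (matchingEdge i))) + ∑[ j < m ] suc (label (liftEdge k (spokeEdge i b j)))
      ≡⟨ cong₂ (λ x y → suc x + y) (label-matchingEdge k i)
               (sum-cong-≗ {m} (λ j → cong suc (label-spokeEdge k i b j))) ⟩
    suc (matchingLabel k i) + ∑[ j < m ] spokeValue b (digit b j) (cell k i)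
      ≡⟨ cong (suc (matchingLabel k i) +_) (∑-digit b (λ d → spokeValue b d (cell k i))) ⟩
    suc (matchingLabel k i) + ∑[ d < m ] spokeValue b d (cell k i)
      ≡⟨ matching-sum b (cell k i) ⟩
    matchingValue b ∎

  fplus-independent : ∀ k j → fplus G labeling (combine k (iv a j)) ≡ independentValue
  fplus-independent k j = begin
    fplus G labeling (combine k (iv a j))
      ≡⟨ fplus-copy k (iv a j) ⟩
    incidentSum (suc ∘ label ∘ liftEdge k) (iv a j) (joinEdges a m)
      ≡⟨ incidentSum-iv (suc ∘ label ∘ liftEdge k) j ⟩
    ∑[ i < a ] ∑[ b < 2 ] suc (label (liftEdge k (spokeEdge i b j)))
      ≡⟨ sum-cong-≗ {a} (λ i → sum-cong-≗ {2} (λ b → cong suc (label-spokeEdge k i b j))) ⟩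
    ∑[ i < a ] spokePair j (cell k i)
      ≡⟨ independent-sum k j ⟩
    independentValue ∎

  0<P : 0 < P
  0<P = ℕP.*-mono-≤ (ℕP.m≤n+m 1 (2 * suc t)) (ℕP.m≤n+m 1 (2 * r))

  matchingValues-≢ : matchingValue zero ≢ matchingValue (suc zero)
  matchingValues-≢ = ℕP.<⇒≢ (ℕP.+-monoʳ-< (suc n * (suc Q + P)) 0<mP)
    where
    0<mP : 0 < 1 * (m * P)
    0<mP = subst (0 <_) (sym (ℕP.*-identityˡ (m * P))) (ℕP.*-mono-≤ (ℕP.m≤n+m 1 (2 * n)) 0<P)

  matching≢independent : ∀ b → matchingValue b ≢ independentValue
  matching≢independent zero = matching≢multiple n P a 0 0<P z≤n
  matching≢independent (suc zero) = matching≢multiple n P a 1 0<P ℕP.≤-refl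

  colours : List ℕ
  colours = matchingValue zero ∷ matchingValue (suc zero) ∷ independentValue ∷ []

  colours-unique : Unique colours
  colours-unique = (matchingValues-≢ ∷ matching≢independent zero ∷ [])
                 ∷ (matching≢independent (suc zero) ∷ []) ∷ [] ∷ []

  fplus-∈-colours : ∀ u → fplus G labeling u ∈ colours
  fplus-∈-colours = vertex-elim (λ u → fplus G labeling u ∈ colours)
    (λ { k i zero → here (fplus-matching k i zero)
       ; k i (suc zero) → there (here (fplus-matching k i (suc zero))) })
    (λ k j → there (there (here (fplus-independent k j))))

  k₀ : Fin c
  k₀ = greatest (2 * r)

  i₀ : Fin a
  i₀ = greatest (2 * suc t)

  j₀ : Fin m
  j₀ = greatest (2 * n)

  colours-attained : ∀ {x} → x ∈ colours → ∃ λ u → fplus G labeling u ≡ x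
  colours-attained (here refl) = combine k₀ (mv m i₀ zero) , fplus-matching k₀ i₀ zero
  colours-attained (there (here refl)) = combine k₀ (mv m i₀ (suc zero)) , fplus-matching k₀ i₀ (suc zero)
  colours-attained (there (there (here refl))) = combine k₀ (iv a j₀) , fplus-independent k₀ j₀

  endpoints-differ : ∀ {e} → e ∈ E G → fplus G labeling (proj₁ e) ≢ fplus G labeling (proj₂ e)
  endpoints-differ = edge-elim (λ e → fplus G labeling (proj₁ e) ≢ fplus G labeling (proj₂ e))
    (λ k i eq → matchingValues-≢
                  (trans (sym (fplus-matching k i zero)) (trans eq (fplus-matching k i (suc zero)))))
    (λ k i b j eq → matching≢independent b
                      (trans (sym (fplus-matching k i b)) (trans eq (fplus-independent k j))))

  labeling-localAntimagic : IsLocalAntimagic G labeling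
  labeling-localAntimagic = labeling-bijective , λ i → endpoints-differ (∈P.∈-lookup i)

  numColours-labeling : numColours G labeling ≡ 3
  numColours-labeling = numColours-≡ G labeling colours-unique fplus-∈-colours colours-attained

  3≤numColours : ∀ f → IsLocalAntimagic G f → 3 ≤ numColours G f
  3≤numColours f lam = triangle⇒3≤numColours G f lam
    (∈-copies⁺ Join k₀ (matchingEdge-∈ i₀))
    (∈-copies⁺ Join k₀ (spokeEdge-∈ i₀ zero j₀))
    (∈-copies⁺ Join k₀ (spokeEdge-∈ i₀ (suc zero) j₀))

corollary3p3 : (n r s : ℕ) → 1 ≤ n → 1 ≤ r → 1 ≤ s → ChiLaEq (theGraph n r s) 3
corollary3p3 n r (suc t) _ _ _ = (labeling , labeling-localAntimagic , numColours-labeling) , 3≤numColours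
  where open Construction n r t
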